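{- Let $q$ be an odd prime and $n$ a positive integer. Let $T(n,q)$ be the maximal size of a subset of $\{a,b\}^n$ (with $a\neq b$) in which no two distinct vectors have Hamming distance divisible by $q$. Then: \begin{align*} T(n,q)&\le \binom{n}{q-1}+\binom{n}{q-2}+\dots+\binom{n}{1}+\binom{n}{0}\qquad \text{in general,}\\ T(n,q)&\le \binom{n}{q-1}+\binom{n}{q-3}+\dots+\binom{n}{2}+\binom{n}{0} \qquad\text{if } n\equiv 0 \pmod q,\\ T(n,q)&\ge\binom{n}{q-1}+\binom{n}{q-3}+\dots+\binom{n}{2}+\binom{n}{0}\qquad \text{in general,}\\ T(n,q)&\ge\binom{n}{q-1}+\binom{n}{q-2}+\dots+\binom{n}{1}+\binom{n}{0}\qquad\text{if } n\equiv -1 \pmod q. \end{align*}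
   Context: The Hamming distance of two words of length $n$ is the number of coordinates in which they differ. -}

module Defs where

open import Data.Nat using (ℕ; zero; suc; _+_; _*_; _≤_)
open import Data.Nat.Divisibility using (_∣_)
open import Data.Nat.Combinatorics using (_C_)
open import Data.Bool using (Bool; true; false)
open import Data.Vec using (Vec; []; _∷_)
open import Data.List using (List; length)
open import Data.List.Membership.Propositional using (_∈_)
open import Data.List.Relation.Unary.Unique.Propositional using (Unique)
open import Relation.Binary.PropositionalEquality using (_≡_)
open import Relation.Nullary using (¬_)
open import Data.Product using (_×_)

-- Words of length n over a two-letter alphabet {a,b}, a ≠ b, encoded as Bool.
Word : ℕ → Set
Word n = Vec Bool n

diff : Bool → Bool → ℕ
diff true  true  = 0
diff false false = 0
diff true  false = 1
diff false true  = 1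

hamming : ∀ {n} → Word n → Word n → ℕ
hamming []       []       = 0
hamming (x ∷ xs) (y ∷ ys) = diff x y + hamming xs ys

Good : (n q : ℕ) → List (Word n) → Set
Good n q S = Unique S ×
  (∀ u v → u ∈ S → v ∈ S → ¬ (u ≡ v) → ¬ (q ∣ hamming u v))

binomSum : ℕ → ℕ → ℕ
binomSum n zero    = n C 0
binomSum n (suc k) = n C suc k + binomSum n k

evenBinomSum : ℕ → ℕ → ℕ
evenBinomSum n zero    = n C 0
evenBinomSum n (suc m) = n C (2 * suc m) + evenBinomSum n m

-- Write ⟨u,x⟩ = n − 2·d(u,x) for the ±1 inner product of two words. For u in a good set S,
-- f_u(x) = ∏_{t=1}^{q−1} (⟨u,x⟩ − n − 2t) = ∏_{t=1}^{q−1} −2(d(u,x) + t) is ≡ 0 mod q at every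
-- other v ∈ S, since d(u,v) + t ≡ 0 for some t, but not at u, since q is an odd prime. On
-- {±1}ⁿ the f_u are multilinear of degree ≤ q − 1, so writing f_u(v) = a_u · b_v, the vectors
-- a_u are independent mod q and |S| ≤ Σ_{i<q} C(n,i). When q ∣ n the even polynomials
-- g_u(x) = ∏_{t=1}^{(q−1)/2} (⟨u,x⟩² − 4t²) = ∏ (n − 2(d+t))(n − 2(d−t)) do the same job inside
-- the span of the monomials of even degree ≤ q − 1.
--
-- Conversely, two distinct words whose weights have the same parity and are < q are at an even
-- distance in (0, 2q), which the odd q cannot divide: this gives all words of even weight
-- ≤ q − 1. When q ∣ n + 1, add the complements v̄ of the words of odd weight ≤ q − 2: then
-- d(u,v̄) = n − d(u,v) ≡ −(d(u,v) + 1) mod q, and d(u,v) + 1 is again even and in (0, 2q).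
module Submission where

open import Defs

module Residues where

  open import Data.Nat
  open import Data.Nat.Properties
  open import Data.Nat.DivMod using (_%_; _/_; m≡m%n+[m/n]*n; m%n<n; m*n/n≡m)
  open import Data.Nat.Divisibility using (_∣_; divides; m%n≡0⇒n∣m; ∣m+n∣m⇒∣n; m∣m*n; ∣1⇒≡1)
  open import Data.Empty using (⊥-elim)
  open import Data.Product using (Σ-syntax; _×_; _,_)
  open import Function using (case_of_)
  open import Relation.Nullary using (¬_)
  open import Relation.Binary.PropositionalEquality using (_≡_; refl; sym; trans; cong; subst; module ≡-Reasoning)

  odd⇒≡1+2* : ∀ {q} → ¬ 2 ∣ q → Σ[ h ∈ ℕ ] q ≡ suc (2 * h)
  odd⇒≡1+2* {q} 2∤q with q % 2 | m≡m%n+[m/n]*n q 2 | m%n<n q 2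
  ... | 0           | q≡ | _ = ⊥-elim (2∤q (divides (q / 2) q≡))
  ... | 1           | q≡ | _ = q / 2 , trans q≡ (cong suc (*-comm (q / 2) 2))
  ... | suc (suc _) | _  | s≤s (s≤s ())

  2∤1+2* : ∀ h → ¬ 2 ∣ suc (2 * h)
  2∤1+2* h 2∣ = case ∣1⇒≡1 (∣m+n∣m⇒∣n (subst (2 ∣_) (+-comm 1 (2 * h)) 2∣) (m∣m*n h)) of λ ()

  2*n/2≡n : ∀ n → 2 * n / 2 ≡ n
  2*n/2≡n n = trans (cong (_/ 2) (*-comm 2 n)) (m*n/n≡m n 2)

  m<o⇒n<o⇒m+n<2*o : ∀ {m n o} → m < o → n < o → m + n < 2 * o
  m<o⇒n<o⇒m+n<2*o {m} {n} {o} m<o n<o = subst (m + n <_) (cong (o +_) (sym (+-identityʳ o))) (+-mono-< m<o n<o)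

  odd∤even<2* : ∀ {q d} → ¬ 2 ∣ q → 2 ∣ d → 0 < d → d < 2 * q → ¬ q ∣ d
  odd∤even<2*     _   _   0<d _    (divides zero          refl) = <-irrefl refl 0<d
  odd∤even<2* {q} 2∤q 2∣d _   _    (divides (suc zero)    refl) = 2∤q (subst (2 ∣_) (+-identityʳ q) 2∣d)
  odd∤even<2* {q} _   _   _   d<2q (divides (suc (suc k)) refl) = <⇒≱ d<2q (+-monoʳ-≤ q (+-monoʳ-≤ q z≤n))

  module _ (q : ℕ) .{{_ : NonZero q}} (d : ℕ) where

    ∤⇒0<% : ¬ q ∣ d → 0 < d % q
    ∤⇒0<% q∤d with d % q in r≡0
    ... | zero  = ⊥-elim (q∤d (m%n≡0⇒n∣m d q r≡0))
    ... | suc _ = s≤s z≤n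

    ∣+[∸%] : q ∣ d + (q ∸ d % q)
    ∣+[∸%] = divides (suc (d / q)) (begin
      d + (q ∸ d % q)                   ≡⟨ cong (_+ (q ∸ d % q)) (m≡m%n+[m/n]*n d q) ⟩
      d % q + d / q * q + (q ∸ d % q)   ≡⟨ cong (_+ (q ∸ d % q)) (+-comm (d % q) (d / q * q)) ⟩
      d / q * q + d % q + (q ∸ d % q)   ≡⟨ +-assoc (d / q * q) (d % q) (q ∸ d % q) ⟩
      d / q * q + (d % q + (q ∸ d % q)) ≡⟨ cong (d / q * q +_) (m+[n∸m]≡n (<⇒≤ (m%n<n d q))) ⟩
      d / q * q + q                     ≡⟨ +-comm (d / q * q) q ⟩
      suc (d / q) * q                   ∎)
      where open ≡-Reasoning

  ∤⇒∣+ : ∀ q .{{_ : NonZero q}} d → ¬ q ∣ d → Σ[ t ∈ ℕ ] 1 ≤ t × t < q × q ∣ d + t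
  ∤⇒∣+ q d q∤d =
    q ∸ d % q , m<n⇒0<n∸m (m%n<n d q) , ∸-monoʳ-< (∤⇒0<% q d q∤d) (<⇒≤ (m%n<n d q)) , ∣+[∸%] q d

module Hamming where

  open Residues using (odd∤even<2*)
  open import Data.Nat
  open import Data.Nat.Properties
  open import Data.Nat.Divisibility using (_∣_; ∣m+n∣m⇒∣n; m∣m*n)
  open import Data.Nat.Tactic.RingSolver using (solve-∀)
  open import Data.Bool using (true; false; not)
  open import Data.Bool.Properties using (not-involutive)
  open import Data.Vec using ([]; _∷_; map)
  open import Function using (_∘_)
  open import Relation.Nullary using (¬_)
  open import Relation.Binary.PropositionalEquality using (_≡_; _≢_; refl; sym; trans; cong; cong₂; subst; module ≡-Reasoning)

  weight : ∀ {n} → Word n → ℕ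
  weight []          = 0
  weight (false ∷ x) = weight x
  weight (true  ∷ x) = suc (weight x)

  sharedOnes : ∀ {n} → Word n → Word n → ℕ
  sharedOnes []         []         = 0
  sharedOnes (true ∷ u) (true ∷ v) = suc (sharedOnes u v)
  sharedOnes (_ ∷ u)    (_ ∷ v)    = sharedOnes u v

  complement : ∀ {n} → Word n → Word n
  complement = map not

  hamming+2*sharedOnes : ∀ {n} (u v : Word n) → hamming u v + 2 * sharedOnes u v ≡ weight u + weight v
  hamming+2*sharedOnes []          []          = refl
  hamming+2*sharedOnes (false ∷ u) (false ∷ v) = hamming+2*sharedOnes u v
  hamming+2*sharedOnes (false ∷ u) (true ∷ v)  = trans (cong suc (hamming+2*sharedOnes u v)) (sym (+-suc (weight u) (weight v)))
  hamming+2*sharedOnes (true ∷ u)  (false ∷ v) = cong suc (hamming+2*sharedOnes u v)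
  hamming+2*sharedOnes (true ∷ u)  (true ∷ v)  = begin
    hamming u v + 2 * suc (sharedOnes u v)       ≡⟨ shift (hamming u v) (sharedOnes u v) ⟩
    suc (suc (hamming u v + 2 * sharedOnes u v)) ≡⟨ cong (λ m → suc (suc m)) (hamming+2*sharedOnes u v) ⟩
    suc (suc (weight u + weight v))              ≡⟨ cong suc (sym (+-suc (weight u) (weight v))) ⟩
    suc (weight u + suc (weight v))              ∎
    where
    open ≡-Reasoning
    shift : ∀ d o → d + 2 * suc o ≡ suc (suc (d + 2 * o))
    shift = solve-∀

  hamming-self : ∀ {n} (u : Word n) → hamming u u ≡ 0
  hamming-self []          = refl
  hamming-self (false ∷ u) = hamming-self u
  hamming-self (true ∷ u)  = hamming-self u

  hamming≡0⇒≡ : ∀ {n} {u v : Word n} → hamming u v ≡ 0 → u ≡ v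
  hamming≡0⇒≡ {u = []}        {[]}        _   = refl
  hamming≡0⇒≡ {u = false ∷ u} {false ∷ v} d≡0 = cong (false ∷_) (hamming≡0⇒≡ d≡0)
  hamming≡0⇒≡ {u = true ∷ u}  {true ∷ v}  d≡0 = cong (true ∷_) (hamming≡0⇒≡ d≡0)

  hamming-sym : ∀ {n} (u v : Word n) → hamming u v ≡ hamming v u
  hamming-sym []      []      = refl
  hamming-sym (a ∷ u) (b ∷ v) = cong₂ _+_ (diff-sym a b) (hamming-sym u v)
    where
    diff-sym : ∀ a b → diff a b ≡ diff b a
    diff-sym false false = refl
    diff-sym false true  = refl
    diff-sym true  false = refl
    diff-sym true  true  = refl

  hamming-complement : ∀ {n} (u v : Word n) → hamming (complement u) (complement v) ≡ hamming u v
  hamming-complement []      []      = refl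
  hamming-complement (a ∷ u) (b ∷ v) = cong₂ _+_ (diff-not a b) (hamming-complement u v)
    where
    diff-not : ∀ a b → diff (not a) (not b) ≡ diff a b
    diff-not false false = refl
    diff-not false true  = refl
    diff-not true  false = refl
    diff-not true  true  = refl

  hamming-complementʳ+hamming : ∀ {n} (u v : Word n) → hamming u (complement v) + hamming u v ≡ n
  hamming-complementʳ+hamming []      []      = refl
  hamming-complementʳ+hamming {suc n} (a ∷ u) (b ∷ v) = begin
    diff a (not b) + hamming u (complement v) + (diff a b + hamming u v)
      ≡⟨ +-comm-middle (diff a (not b)) (hamming u (complement v)) (diff a b) (hamming u v) ⟩
    (diff a (not b) + diff a b) + (hamming u (complement v) + hamming u v)
      ≡⟨ cong₂ _+_ (diff-not+diff a b) (hamming-complementʳ+hamming u v) ⟩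
    suc n ∎
    where
    open ≡-Reasoning
    +-comm-middle : ∀ a b c d → a + b + (c + d) ≡ (a + c) + (b + d)
    +-comm-middle = solve-∀
    diff-not+diff : ∀ a b → diff a (not b) + diff a b ≡ 1
    diff-not+diff false false = refl
    diff-not+diff false true  = refl
    diff-not+diff true  false = refl
    diff-not+diff true  true  = refl

  complement-involutive : ∀ {n} (u : Word n) → complement (complement u) ≡ u
  complement-involutive []      = refl
  complement-involutive (a ∷ u) = cong₂ _∷_ (not-involutive a) (complement-involutive u)

  complement-injective : ∀ {n} {u v : Word n} → complement u ≡ complement v → u ≡ v
  complement-injective {u = u} {v} eq =
    trans (sym (complement-involutive u)) (trans (cong complement eq) (complement-involutive v))

  even-weights⇒even-hamming : ∀ k {n} (u v : Word n) → 2 ∣ k + (weight u + weight v) → 2 ∣ k + hamming u v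
  even-weights⇒even-hamming k u v 2∣ = ∣m+n∣m⇒∣n (subst (2 ∣_) regroup 2∣) (m∣m*n (sharedOnes u v))
    where
    swap : ∀ k d o → k + (d + 2 * o) ≡ 2 * o + (k + d)
    swap = solve-∀
    regroup : k + (weight u + weight v) ≡ 2 * sharedOnes u v + (k + hamming u v)
    regroup = trans (cong (k +_) (sym (hamming+2*sharedOnes u v))) (swap k (hamming u v) (sharedOnes u v))

  hamming≤weight+weight : ∀ {n} (u v : Word n) → hamming u v ≤ weight u + weight v
  hamming≤weight+weight u v = subst (hamming u v ≤_) (hamming+2*sharedOnes u v) (m≤m+n _ _)

  module _ {q : ℕ} (2∤q : ¬ 2 ∣ q) where

    ¬∣hamming : ∀ {n} {u v : Word n} → u ≢ v → 2 ∣ weight u + weight v → weight u + weight v < 2 * q →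
                ¬ q ∣ hamming u v
    ¬∣hamming {u = u} {v} u≢v 2∣ bound = odd∤even<2* 2∤q (even-weights⇒even-hamming 0 u v 2∣)
      (n≢0⇒n>0 (u≢v ∘ hamming≡0⇒≡)) (≤-<-trans (hamming≤weight+weight u v) bound)

    ¬∣hamming-complement : ∀ {n} → q ∣ suc n → (u v : Word n) → 2 ∣ suc (weight u + weight v) →
                           suc (weight u + weight v) < 2 * q → ¬ q ∣ hamming u (complement v)
    ¬∣hamming-complement {n} q∣1+n u v 2∣ bound q∣d =
      odd∤even<2* 2∤q (even-weights⇒even-hamming 1 u v 2∣) (s≤s z≤n)
        (≤-<-trans (s≤s (hamming≤weight+weight u v)) bound) q∣1+d
      where
      1+n≡ : suc n ≡ hamming u (complement v) + suc (hamming u v)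
      1+n≡ = sym (trans (+-suc _ _) (cong suc (hamming-complementʳ+hamming u v)))
      q∣1+d : q ∣ suc (hamming u v)
      q∣1+d = ∣m+n∣m⇒∣n (subst (q ∣_) 1+n≡ q∣1+n) q∣d

module BiorthogonalRank where

  open import Data.Nat as ℕ using (suc; z≤n; s≤s)
  open import Data.Integer using (ℤ; _+_; _*_; _-_; 0ℤ)
  open import Data.Integer.Properties using (*-zeroʳ; +-identityˡ; +-assoc)
  open import Data.Integer.Divisibility.Signed
    using (_∣_; _∣?_; divides; ∣m∣n⇒∣m+n; ∣m∣n⇒∣m-n; ∣n⇒∣m*n; ∣m+n∣n⇒∣m; ∣m⇒∣-m)
  open import Data.Integer.Tactic.RingSolver using (solve-∀)
  open import Data.Fin using (Fin; zero; suc)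
  open import Data.Vec using (Vec; []; _∷_; _++_; map; lookup; removeAt; zipWith)
  open import Data.Vec.Properties using (lookup-zipWith)
  open import Data.List using (List; []; _∷_; length)
  open import Data.List.Membership.Propositional using (_∈_)
  open import Data.List.Relation.Unary.Any using (here; there)
  open import Data.List.Relation.Unary.All as All using (All)
  open import Data.List.Relation.Unary.Unique.Propositional using (Unique)
  open import Data.List.Relation.Unary.AllPairs using (_∷_)
  open import Data.Empty using (⊥-elim)
  open import Data.Product using (Σ-syntax; _,_)
  open import Data.Sum using (_⊎_; [_,_]′)
  open import Relation.Nullary using (¬_; yes; no)
  open import Relation.Binary.PropositionalEquality using (_≡_; _≢_; refl; sym; trans; cong; subst; module ≡-Reasoning)

  dot : ∀ {m} → Vec ℤ m → Vec ℤ m → ℤ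
  dot []       []       = 0ℤ
  dot (x ∷ xs) (y ∷ ys) = x * y + dot xs ys

  dot-++ : ∀ {m l} (a b : Vec ℤ m) (c d : Vec ℤ l) → dot (a ++ c) (b ++ d) ≡ dot a b + dot c d
  dot-++ []      []      c d = sym (+-identityˡ (dot c d))
  dot-++ (x ∷ a) (y ∷ b) c d = trans (cong (x * y +_) (dot-++ a b c d)) (sym (+-assoc (x * y) (dot a b) (dot c d)))

  dot-map-* : ∀ {m} s (a b : Vec ℤ m) → dot a (map (s *_) b) ≡ s * dot a b
  dot-map-* s []      []      = sym (*-zeroʳ s)
  dot-map-* s (x ∷ a) (y ∷ b) = trans (cong (x * (s * y) +_) (dot-map-* s a b)) (pull s x y (dot a b))
    where
    pull : ∀ s x y z → x * (s * y) + s * z ≡ s * (x * y + z)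
    pull = solve-∀

  dot-removeAt : ∀ {m} (v w : Vec ℤ (suc m)) j →
                 dot v w ≡ lookup v j * lookup w j + dot (removeAt v j) (removeAt w j)
  dot-removeAt (x ∷ v)         (y ∷ w)         zero    = refl
  dot-removeAt (x ∷ v@(_ ∷ _)) (y ∷ w@(_ ∷ _)) (suc j) =
    trans (cong (x * y +_) (dot-removeAt v w j)) (swap (x * y) (lookup v j * lookup w j) (dot (removeAt v j) (removeAt w j)))
    where
    swap : ∀ a b c → a + (b + c) ≡ b + (a + c)
    swap = solve-∀

  dot-linear : ∀ {m} α β (a v w : Vec ℤ m) →
               dot a (zipWith (λ x y → α * x - β * y) v w) ≡ α * dot a v - β * dot a w
  dot-linear α β [] [] [] = zero-combination α β
    where
    zero-combination : ∀ α β → 0ℤ ≡ α * 0ℤ - β * 0ℤ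
    zero-combination = solve-∀
  dot-linear α β (x ∷ a) (y ∷ v) (z ∷ w) =
    trans (cong (x * (α * y - β * z) +_) (dot-linear α β a v w)) (distrib α β x y z (dot a v) (dot a w))
    where
    distrib : ∀ α β x y z D E → x * (α * y - β * z) + (α * D - β * E) ≡ α * (x * y + D) - β * (x * z + E)
    distrib = solve-∀

  eliminate : ∀ {m} (j : Fin (suc m)) (pivot v : Vec ℤ (suc m)) → Vec ℤ m
  eliminate j pivot v = removeAt (zipWith (λ x y → lookup pivot j * x - lookup v j * y) v pivot) j

  dot-eliminate : ∀ {m} (a pivot v : Vec ℤ (suc m)) j →
                  dot (removeAt a j) (eliminate j pivot v) ≡ lookup pivot j * dot a v - lookup v j * dot a pivot
  dot-eliminate a pivot v j = begin
    dot a′ (removeAt L j)                           ≡⟨ sym (+-identityˡ _) ⟩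
    0ℤ + dot a′ (removeAt L j)                      ≡⟨ cong (_+ dot a′ (removeAt L j)) (sym (*-zeroʳ (lookup a j))) ⟩
    lookup a j * 0ℤ + dot a′ (removeAt L j)         ≡⟨ cong (λ t → lookup a j * t + dot a′ (removeAt L j)) (sym L[j]≡0) ⟩
    lookup a j * lookup L j + dot a′ (removeAt L j) ≡⟨ sym (dot-removeAt a L j) ⟩
    dot a L                                         ≡⟨ dot-linear (lookup pivot j) (lookup v j) a v pivot ⟩
    lookup pivot j * dot a v - lookup v j * dot a pivot ∎
    where
    open ≡-Reasoning
    a′ = removeAt a j
    L = zipWith (λ x y → lookup pivot j * x - lookup v j * y) v pivot
    cancel : ∀ x y → x * y - y * x ≡ 0ℤ
    cancel = solve-∀
    L[j]≡0 : lookup L j ≡ 0ℤ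
    L[j]≡0 = trans (lookup-zipWith _ j v pivot) (cancel (lookup pivot j) (lookup v j))

  record BiorthogonalMod {X : Set} (P : ℤ) (S : List X) {m} (a b : X → Vec ℤ m) : Set where
    field
      off-diagonal : ∀ {u v} → u ∈ S → v ∈ S → u ≢ v → P ∣ dot (a u) (b v)
      diagonal     : ∀ {u} → u ∈ S → ¬ P ∣ dot (a u) (b u)

  ∤dot⇒∤coordinate : ∀ {P m} (a b : Vec ℤ m) → ¬ P ∣ dot a b → Σ[ j ∈ Fin m ] ¬ P ∣ lookup b j
  ∤dot⇒∤coordinate         []      []      P∤ab = ⊥-elim (P∤ab (divides 0ℤ refl))
  ∤dot⇒∤coordinate {P} (x ∷ a) (y ∷ b) P∤ab with P ∣? y
  ... | no P∤y  = zero , P∤y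
  ... | yes P∣y =
    let j , P∤b[j] = ∤dot⇒∤coordinate a b (λ P∣ab → P∤ab (∣m∣n⇒∣m+n (∣n⇒∣m*n x P∣y) P∣ab))
    in suc j , P∤b[j]

  module _ (P : ℤ) (prime : ∀ x y → P ∣ x * y → P ∣ x ⊎ P ∣ y) {X : Set} where

    -- One step of fraction-free elimination, pivoting on a coordinate where b u₀ is nonzero mod P.
    drop-pivot : ∀ {m} {u₀ : X} {S} {a b : X → Vec ℤ (suc m)} → All (u₀ ≢_) S →
                 BiorthogonalMod P (u₀ ∷ S) a b → ∀ j → ¬ P ∣ lookup (b u₀) j →
                 BiorthogonalMod P S (λ u → removeAt (a u) j) (λ v → eliminate j (b u₀) (b v))
    drop-pivot {u₀ = u₀} {S} {a} {b} u₀∉S bo j P∤β = record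
      { off-diagonal = λ {u} {v} u∈S v∈S u≢v → subst (P ∣_) (sym (dot-eliminate (a u) (b u₀) (b v) j))
          (∣m∣n⇒∣m-n (∣n⇒∣m*n β (off-diagonal (there u∈S) (there v∈S) u≢v)) (P∣a[u]·b[u₀] v u∈S))
      ; diagonal = λ {u} u∈S P∣a′b′ → [ P∤β , diagonal (there u∈S) ]′ (prime β (dot (a u) (b u))
          (∣m+n∣n⇒∣m (subst (P ∣_) (dot-eliminate (a u) (b u₀) (b u) j) P∣a′b′)
                     (∣m⇒∣-m (P∣a[u]·b[u₀] u u∈S))))
      }
      where
      open BiorthogonalMod bo
      β = lookup (b u₀) j
      P∣a[u]·b[u₀] : ∀ v {u} → u ∈ S → P ∣ lookup (b v) j * dot (a u) (b u₀)
      P∣a[u]·b[u₀] v u∈S =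
        ∣n⇒∣m*n (lookup (b v) j) (off-diagonal (there u∈S) (here refl) (λ u≡u₀ → All.lookup u₀∉S u∈S (sym u≡u₀)))

    biorthogonal⇒length≤dim : ∀ {S : List X} → Unique S → ∀ {m} {a b : X → Vec ℤ m} →
                              BiorthogonalMod P S a b → length S ℕ.≤ m
    biorthogonal⇒length≤dim {[]} _ _ = z≤n
    biorthogonal⇒length≤dim {u₀ ∷ S} (u₀∉S ∷ unique) {m} {a} {b} bo
      with ∤dot⇒∤coordinate (a u₀) (b u₀) (BiorthogonalMod.diagonal bo (here refl))
    ... | j , P∤β with m
    ...   | suc _ = s≤s (biorthogonal⇒length≤dim unique (drop-pivot u₀∉S bo j P∤β))

module SignPolynomials where

  open BiorthogonalRank using (dot; dot-++; dot-map-*)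
  open import Data.Nat as ℕ using (ℕ; zero; suc)
  open import Data.Integer as ℤ using (ℤ; _+_; _*_; -_; _-_; 0ℤ; 1ℤ)
  open import Data.Integer.Properties using (*-zeroˡ; *-zeroʳ; *-identityʳ; +-identityˡ; +-identityʳ)
  open import Data.Integer.Tactic.RingSolver using (solve-∀)
  open import Data.Bool using (Bool; true; false)
  open import Data.Unit using (⊤; tt)
  open import Data.Vec using (Vec; []; _∷_; _++_; map)
  open import Data.Product using (_×_; _,_)
  open import Relation.Binary.PropositionalEquality using (_≡_; refl; sym; trans; cong; cong₂; module ≡-Reasoning)

  sign : Bool → ℤ
  sign false = 1ℤ
  sign true  = - 1ℤ

  sign² : ∀ b → sign b * sign b ≡ 1ℤ
  sign² false = refl
  sign² true  = refl

  inner : ∀ {n} → Word n → Word n → ℤ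
  inner []       []       = 0ℤ
  inner (a ∷ u) (b ∷ v) = sign a * sign b + inner u v

  inner-self : ∀ {n} (u : Word n) → inner u u ≡ ℤ.+ n
  inner-self []      = refl
  inner-self (a ∷ u) = cong₂ _+_ (sign² a) (inner-self u)

  -- Poly n k: polynomials over ℤ in the ±1 variables sign x₁, …, sign xₙ of a word x, multilinear,
  -- of degree ≤ k, with every monomial of degree ≡ k (mod 2); p₀ +x· p₁ stands for p₀ + (sign x₁)·p₁,
  -- and Const k holds the constants of parity k (ℤ for even k, only 0 for odd k).
  Const : ℕ → Set
  Const zero          = ℤ
  Const (suc zero)    = ⊤
  Const (suc (suc k)) = Const k

  data Poly : ℕ → ℕ → Set where
    leaf     : ∀ {k} → Const k → Poly zero k
    constant : ∀ {n} → ℤ → Poly (suc n) zero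
    _+x·_    : ∀ {n k} → Poly n (suc k) → Poly n k → Poly (suc n) (suc k)

  dim : ℕ → ℕ → ℕ
  dim zero    zero          = 1
  dim zero    (suc zero)    = 0
  dim zero    (suc (suc k)) = dim zero k
  dim (suc n) zero          = 1
  dim (suc n) (suc k)       = dim n (suc k) ℕ.+ dim n k

  evalConst : ∀ k → Const k → ℤ
  evalConst zero          c = c
  evalConst (suc zero)    _ = 0ℤ
  evalConst (suc (suc k)) c = evalConst k c

  eval : ∀ {n k} → Poly n k → Word n → ℤ
  eval {k = k} (leaf c) []     = evalConst k c
  eval (constant c)     _      = c
  eval (p₀ +x· p₁)     (x ∷ xs) = eval p₀ xs + sign x * eval p₁ xs

  coefficientsConst : ∀ k → Const k → Vec ℤ (dim zero k)
  coefficientsConst zero          c = c ∷ []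
  coefficientsConst (suc zero)    _ = []
  coefficientsConst (suc (suc k)) c = coefficientsConst k c

  coefficients : ∀ {n k} → Poly n k → Vec ℤ (dim n k)
  coefficients {k = k} (leaf c) = coefficientsConst k c
  coefficients (constant c)     = c ∷ []
  coefficients (p₀ +x· p₁)     = coefficients p₀ ++ coefficients p₁

  monomialsConst : ∀ k → Vec ℤ (dim zero k)
  monomialsConst zero          = 1ℤ ∷ []
  monomialsConst (suc zero)    = []
  monomialsConst (suc (suc k)) = monomialsConst k

  monomials : ∀ {n} k → Word n → Vec ℤ (dim n k)
  monomials k       []       = monomialsConst k
  monomials zero    (x ∷ xs) = 1ℤ ∷ []
  monomials (suc k) (x ∷ xs) = monomials (suc k) xs ++ map (sign x *_) (monomials k xs)

  evalConst≡dot : ∀ k (c : Const k) → evalConst k c ≡ dot (coefficientsConst k c) (monomialsConst k)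
  evalConst≡dot zero          c = sym (trans (+-identityʳ (c * 1ℤ)) (*-identityʳ c))
  evalConst≡dot (suc zero)    _ = refl
  evalConst≡dot (suc (suc k)) c = evalConst≡dot k c

  eval≡dot : ∀ {n k} (p : Poly n k) (x : Word n) → eval p x ≡ dot (coefficients p) (monomials k x)
  eval≡dot {k = k} (leaf c) []     = evalConst≡dot k c
  eval≡dot (constant c)     (_ ∷ _) = sym (trans (+-identityʳ (c * 1ℤ)) (*-identityʳ c))
  eval≡dot {k = suc k} (p₀ +x· p₁) (x ∷ xs) = sym (begin
    dot (coefficients p₀ ++ coefficients p₁) (monomials (suc k) xs ++ map (sign x *_) (monomials k xs))
      ≡⟨ dot-++ (coefficients p₀) (monomials (suc k) xs) (coefficients p₁) _ ⟩
    dot (coefficients p₀) (monomials (suc k) xs) + dot (coefficients p₁) (map (sign x *_) (monomials k xs))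
      ≡⟨ cong (λ s → dot (coefficients p₀) (monomials (suc k) xs) + s)
              (dot-map-* (sign x) (coefficients p₁) (monomials k xs)) ⟩
    dot (coefficients p₀) (monomials (suc k) xs) + sign x * dot (coefficients p₁) (monomials k xs)
      ≡⟨ sym (cong₂ (λ a b → a + sign x * b) (eval≡dot p₀ xs) (eval≡dot p₁ xs)) ⟩
    eval p₀ xs + sign x * eval p₁ xs ∎)
    where open ≡-Reasoning

  0Const : ∀ k → Const k
  0Const zero          = 0ℤ
  0Const (suc zero)    = tt
  0Const (suc (suc k)) = 0Const k

  0ᴾ : ∀ {n k} → Poly n k
  0ᴾ {zero}  {k}     = leaf (0Const k)
  0ᴾ {suc n} {zero}  = constant 0ℤ
  0ᴾ {suc n} {suc k} = 0ᴾ +x· 0ᴾ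

  addScaledConst : ∀ k → Const k → ℤ → Const k → Const k
  addScaledConst zero          a c b = a + c * b
  addScaledConst (suc zero)    _ _ _ = tt
  addScaledConst (suc (suc k)) a c b = addScaledConst k a c b

  _+[_]·_ : ∀ {n k} → Poly n k → ℤ → Poly n k → Poly n k
  _+[_]·_ {k = k} (leaf a) c (leaf b) = leaf (addScaledConst k a c b)
  constant a  +[ c ]· constant b  = constant (a + c * b)
  (p₀ +x· p₁) +[ c ]· (q₀ +x· q₁) = (p₀ +[ c ]· q₀) +x· (p₁ +[ c ]· q₁)

  constᴾ : ∀ {n} → ℤ → Poly n zero
  constᴾ {zero}  a = leaf a
  constᴾ {suc n} a = constant a

  raise : ∀ {n k} → Poly n k → Poly n (suc (suc k))
  raise (leaf c)     = leaf c
  raise (constant a) = raise (constᴾ a) +x· 0ᴾ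
  raise (p₀ +x· p₁) = raise p₀ +x· raise p₁

  -- Multiplication by x ↦ inner u x, using (sign x₁)² = 1; with σ = sign u₁ and s the inner product of the tails,
  -- (σx₁ + s)(p₀ + x₁p₁) = (s·p₀ + σ·p₁) + x₁(s·p₁ + σ·p₀).
  inner· : ∀ {n k} → Word n → Poly n k → Poly n (suc k)
  inner· []       _            = 0ᴾ
  inner· (u ∷ us) (constant a) = inner· us (constᴾ a) +x· constᴾ (sign u * a)
  inner· (u ∷ us) (p₀ +x· p₁) = (inner· us p₀ +[ sign u ]· raise p₁) +x· (inner· us p₁ +[ sign u ]· p₀)

  evalConst-0Const : ∀ k → evalConst k (0Const k) ≡ 0ℤ
  evalConst-0Const zero          = refl
  evalConst-0Const (suc zero)    = refl
  evalConst-0Const (suc (suc k)) = evalConst-0Const k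

  eval-0ᴾ : ∀ {n k} (x : Word n) → eval (0ᴾ {n} {k}) x ≡ 0ℤ
  eval-0ᴾ {k = k} []           = evalConst-0Const k
  eval-0ᴾ {k = zero}  (_ ∷ _)  = refl
  eval-0ᴾ {k = suc k} (x ∷ xs) =
    trans (cong₂ (λ a b → a + sign x * b) (eval-0ᴾ {k = suc k} xs) (eval-0ᴾ {k = k} xs))
          (trans (+-identityˡ _) (*-zeroʳ (sign x)))

  evalConst-addScaledConst : ∀ k a c b → evalConst k (addScaledConst k a c b) ≡ evalConst k a + c * evalConst k b
  evalConst-addScaledConst zero          a c b = refl
  evalConst-addScaledConst (suc zero)    a c b = sym (trans (+-identityˡ (c * 0ℤ)) (*-zeroʳ c))
  evalConst-addScaledConst (suc (suc k)) a c b = evalConst-addScaledConst k a c b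

  eval-+[]· : ∀ {n k} (p : Poly n k) c q x → eval (p +[ c ]· q) x ≡ eval p x + c * eval q x
  eval-+[]· {k = k} (leaf a) c (leaf b) [] = evalConst-addScaledConst k a c b
  eval-+[]· (constant a)  c (constant b)  _        = refl
  eval-+[]· (p₀ +x· p₁) c (q₀ +x· q₁) (x ∷ xs) =
    trans (cong₂ (λ a b → a + sign x * b) (eval-+[]· p₀ c q₀ xs) (eval-+[]· p₁ c q₁ xs))
          (regroup (eval p₀ xs) (eval q₀ xs) (eval p₁ xs) (eval q₁ xs) c (sign x))
    where
    regroup : ∀ p₀ q₀ p₁ q₁ c s → p₀ + c * q₀ + s * (p₁ + c * q₁) ≡ p₀ + s * p₁ + c * (q₀ + s * q₁)
    regroup = solve-∀

  eval-constᴾ : ∀ {n} a (x : Word n) → eval (constᴾ a) x ≡ a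
  eval-constᴾ a []      = refl
  eval-constᴾ a (_ ∷ _) = refl

  eval-raise : ∀ {n k} (p : Poly n k) x → eval (raise p) x ≡ eval p x
  eval-raise (leaf c)      []       = refl
  eval-raise (constant a)  (x ∷ xs) =
    trans (cong₂ (λ a b → a + sign x * b) (trans (eval-raise (constᴾ a) xs) (eval-constᴾ a xs)) (eval-0ᴾ {k = 1} xs))
          (trans (cong (a +_) (*-zeroʳ (sign x))) (+-identityʳ a))
  eval-raise (p₀ +x· p₁) (x ∷ xs) = cong₂ (λ a b → a + sign x * b) (eval-raise p₀ xs) (eval-raise p₁ xs)

  eval-inner· : ∀ {n k} (u : Word n) (p : Poly n k) x → eval (inner· u p) x ≡ inner u x * eval p x
  eval-inner· {k = k} [] (leaf c) [] = trans (eval-0ᴾ {k = suc k} []) (sym (*-zeroˡ (evalConst k c)))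
  eval-inner· (u ∷ us) (constant a) (x ∷ xs) =
    trans (cong₂ (λ A B → A + sign x * B)
                 (trans (eval-inner· us (constᴾ a) xs) (cong (inner us xs *_) (eval-constᴾ a xs)))
                 (eval-constᴾ (sign u * a) xs))
          (factor (inner us xs) a (sign u) (sign x))
    where
    factor : ∀ s a σ y → s * a + y * (σ * a) ≡ (σ * y + s) * a
    factor = solve-∀
  eval-inner· (u ∷ us) (p₀ +x· p₁) (x ∷ xs) = begin
    eval (inner· us p₀ +[ σ ]· raise p₁) xs + sign x * eval (inner· us p₁ +[ σ ]· p₀) xs
      ≡⟨ cong₂ (λ A B → A + sign x * B) even-part odd-part ⟩
    (s * P₀ + σ * P₁) + sign x * (s * P₁ + σ * P₀)
      ≡⟨ expand s P₀ P₁ σ (sign x) ⟩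
    (σ * sign x + s) * (P₀ + sign x * P₁) + σ * P₁ * (1ℤ - sign x * sign x)
      ≡⟨ cong (λ t → (σ * sign x + s) * (P₀ + sign x * P₁) + σ * P₁ * (1ℤ - t)) (sign² x) ⟩
    (σ * sign x + s) * (P₀ + sign x * P₁) + σ * P₁ * (1ℤ - 1ℤ)
      ≡⟨ drop ((σ * sign x + s) * (P₀ + sign x * P₁)) (σ * P₁) ⟩
    (σ * sign x + s) * (P₀ + sign x * P₁) ∎
    where
    open ≡-Reasoning
    σ = sign u
    s = inner us xs
    P₀ = eval p₀ xs
    P₁ = eval p₁ xs
    even-part : eval (inner· us p₀ +[ σ ]· raise p₁) xs ≡ s * P₀ + σ * P₁
    even-part = trans (eval-+[]· (inner· us p₀) σ (raise p₁) xs)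
                      (cong₂ (λ A B → A + σ * B) (eval-inner· us p₀ xs) (eval-raise p₁ xs))
    odd-part : eval (inner· us p₁ +[ σ ]· p₀) xs ≡ s * P₁ + σ * P₀
    odd-part = trans (eval-+[]· (inner· us p₁) σ p₀ xs) (cong (_+ σ * P₀) (eval-inner· us p₁ xs))
    expand : ∀ s p r σ y → s * p + σ * r + y * (s * r + σ * p) ≡
             (σ * y + s) * (p + y * r) + σ * r * (1ℤ - y * y)
    expand = solve-∀
    drop : ∀ a b → a + b * (1ℤ - 1ℤ) ≡ a
    drop = solve-∀

  PolyPair : ℕ → ℕ → Set
  PolyPair n r = Poly n (suc r) × Poly n r

  evalPair : ∀ {n r} → PolyPair n r → Word n → ℤ
  evalPair (p , p′) x = eval p x + eval p′ x

  coefficientsPair : ∀ {n r} → PolyPair n r → Vec ℤ (dim n (suc r) ℕ.+ dim n r)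
  coefficientsPair (p , p′) = coefficients p ++ coefficients p′

  monomialsPair : ∀ {n} r → Word n → Vec ℤ (dim n (suc r) ℕ.+ dim n r)
  monomialsPair r x = monomials (suc r) x ++ monomials r x

  evalPair≡dot : ∀ {n r} (pp : PolyPair n r) x → evalPair pp x ≡ dot (coefficientsPair pp) (monomialsPair r x)
  evalPair≡dot {r = r} (p , p′) x =
    trans (cong₂ _+_ (eval≡dot p x) (eval≡dot p′ x))
          (sym (dot-++ (coefficients p) (monomials (suc r) x) (coefficients p′) (monomials r x)))

  mulAffine : ∀ {n r} → Word n → ℤ → PolyPair n r → PolyPair n (suc r)
  mulAffine u c (p , p′) = inner· u p +[ c ]· raise p′ , inner· u p′ +[ c ]· p

  eval-mulAffine : ∀ {n r} u c (pp : PolyPair n r) x → evalPair (mulAffine u c pp) x ≡ (inner u x + c) * evalPair pp x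
  eval-mulAffine u c (p , p′) x = begin
    eval (inner· u p +[ c ]· raise p′) x + eval (inner· u p′ +[ c ]· p) x
      ≡⟨ cong₂ _+_ (eval-+[]· (inner· u p) c (raise p′) x) (eval-+[]· (inner· u p′) c p x) ⟩
    eval (inner· u p) x + c * eval (raise p′) x + (eval (inner· u p′) x + c * eval p x)
      ≡⟨ cong₂ (λ A B → A + c * B + (eval (inner· u p′) x + c * eval p x)) (eval-inner· u p x) (eval-raise p′ x) ⟩
    inner u x * eval p x + c * eval p′ x + (eval (inner· u p′) x + c * eval p x)
      ≡⟨ cong (λ A → inner u x * eval p x + c * eval p′ x + (A + c * eval p x)) (eval-inner· u p′ x) ⟩
    inner u x * eval p x + c * eval p′ x + (inner u x * eval p′ x + c * eval p x)
      ≡⟨ factor (inner u x) c (eval p x) (eval p′ x) ⟩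
    (inner u x + c) * (eval p x + eval p′ x) ∎
    where
    open ≡-Reasoning
    factor : ∀ s c a b → s * a + c * b + (s * b + c * a) ≡ (s + c) * (a + b)
    factor = solve-∀

module Dimension where

  open SignPolynomials using (dim)
  open import Data.Nat
  open import Data.Nat.Properties using (+-comm; *-suc)
  open import Data.Nat.Combinatorics using (_C_; nCk+nC[k+1]≡[n+1]C[k+1])
  open import Data.Nat.Tactic.RingSolver using (solve-∀)
  open import Relation.Binary.PropositionalEquality using (_≡_; refl; sym; trans; cong; cong₂; module ≡-Reasoning)

  double : ℕ → ℕ
  double zero    = zero
  double (suc h) = suc (suc (double h))

  double≡2* : ∀ h → double h ≡ 2 * h
  double≡2* zero    = refl
  double≡2* (suc h) = trans (cong (λ t → suc (suc t)) (double≡2* h)) (sym (*-suc 2 h))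

  pascal : ∀ n k → suc n C suc k ≡ n C k + n C suc k
  pascal n k = sym (nCk+nC[k+1]≡[n+1]C[k+1] n k)

  dim-0 : ∀ n → dim n 0 ≡ n C 0
  dim-0 zero    = refl
  dim-0 (suc n) = refl

  dim-1 : ∀ n → dim n 1 ≡ n C 1
  dim-1 zero    = refl
  dim-1 (suc n) = begin
    dim n 1 + dim n 0 ≡⟨ cong₂ _+_ (dim-1 n) (dim-0 n) ⟩
    n C 1 + n C 0     ≡⟨ +-comm (n C 1) (n C 0) ⟩
    n C 0 + n C 1     ≡⟨ sym (pascal n 0) ⟩
    suc n C 1         ∎
    where open ≡-Reasoning

  dim-+2 : ∀ n k → dim n (suc (suc k)) ≡ n C suc (suc k) + dim n k
  dim-+2 zero    k       = refl
  dim-+2 (suc n) zero    = begin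
    dim n 2 + dim n 1               ≡⟨ cong₂ _+_ (dim-+2 n 0) (dim-1 n) ⟩
    n C 2 + dim n 0 + n C 1         ≡⟨ cong (λ t → n C 2 + t + n C 1) (dim-0 n) ⟩
    n C 2 + n C 0 + n C 1           ≡⟨ rearrange (n C 0) (n C 1) (n C 2) ⟩
    n C 1 + n C 2 + n C 0           ≡⟨ cong (_+ n C 0) (sym (pascal n 1)) ⟩
    suc n C 2 + n C 0               ∎
    where
    open ≡-Reasoning
    rearrange : ∀ a b c → c + a + b ≡ b + c + a
    rearrange = solve-∀
  dim-+2 (suc n) (suc k) = begin
    dim n (3 + k) + dim n (2 + k)                   ≡⟨ cong₂ _+_ (dim-+2 n (suc k)) (dim-+2 n k) ⟩
    n C (3 + k) + dim n (suc k) + (n C (2 + k) + dim n k) ≡⟨ rearrange (n C (2 + k)) (n C (3 + k)) (dim n (suc k)) (dim n k) ⟩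
    n C (2 + k) + n C (3 + k) + (dim n (suc k) + dim n k) ≡⟨ cong (_+ (dim n (suc k) + dim n k)) (sym (pascal n (2 + k))) ⟩
    suc n C (3 + k) + (dim n (suc k) + dim n k)      ∎
    where
    open ≡-Reasoning
    rearrange : ∀ a b c d → b + c + (a + d) ≡ a + b + (c + d)
    rearrange = solve-∀

  binomSum≡dim+dim : ∀ n r → binomSum n (suc r) ≡ dim n (suc r) + dim n r
  binomSum≡dim+dim n zero    = sym (cong₂ _+_ (dim-1 n) (dim-0 n))
  binomSum≡dim+dim n (suc r) = begin
    n C (2 + r) + binomSum n (suc r)         ≡⟨ cong (n C (2 + r) +_) (binomSum≡dim+dim n r) ⟩
    n C (2 + r) + (dim n (suc r) + dim n r)  ≡⟨ rearrange (n C (2 + r)) (dim n (suc r)) (dim n r) ⟩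
    n C (2 + r) + dim n r + dim n (suc r)    ≡⟨ cong (_+ dim n (suc r)) (sym (dim-+2 n r)) ⟩
    dim n (2 + r) + dim n (suc r)            ∎
    where
    open ≡-Reasoning
    rearrange : ∀ a b c → a + (b + c) ≡ a + c + b
    rearrange = solve-∀

  evenBinomSum≡dim : ∀ n h → evenBinomSum n h ≡ dim n (double h)
  evenBinomSum≡dim n zero    = sym (dim-0 n)
  evenBinomSum≡dim n (suc h) = begin
    n C (2 * suc h) + evenBinomSum n h         ≡⟨ cong₂ _+_ (cong (n C_) (sym (double≡2* (suc h)))) (evenBinomSum≡dim n h) ⟩
    n C double (suc h) + dim n (double h)      ≡⟨ sym (dim-+2 n (double h)) ⟩
    dim n (double (suc h))                     ∎
    where open ≡-Reasoning

module UpperBounds where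

  open Residues using (2∤1+2*; ∤⇒∣+; ∤⇒0<%; ∣+[∸%])
  open Hamming using (hamming-self)
  open BiorthogonalRank
  open SignPolynomials
  open Dimension using (double; binomSum≡dim+dim; evenBinomSum≡dim)
  open import Data.Nat as ℕ using (ℕ; zero; suc; z≤n; s≤s; _≤_; _<_; _∸_)
  import Data.Nat.Properties as ℕ
  open import Data.Nat.DivMod using (_%_; _/_; m≡m%n+[m/n]*n; m%n<n)
  import Data.Nat.Divisibility as ℕ
  open import Data.Nat.Primality using (Prime; euclidsLemma; ¬prime[1])
  open import Data.Integer as ℤ using (ℤ; +_; _+_; _*_; -_; _-_; 1ℤ)
  open import Data.Integer.Properties using (abs-*; neg-involutive)
  open import Data.Integer.Divisibility.Signed
    using (_∣_; ∣ᵤ⇒∣; ∣⇒∣ᵤ; ∣m∣n⇒∣m-n; ∣n⇒∣m*n; ∣m⇒∣m*n; ∣m+n∣m⇒∣n; ∣m⇒∣-m)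
  open import Data.Integer.Tactic.RingSolver using (solve-∀)
  open import Data.Bool using (true; false)
  open import Data.Vec using ([]; _∷_)
  open import Data.List using (length)
  open import Data.Product using (Σ-syntax; _×_; _,_)
  open import Data.Sum using (_⊎_; inj₁; inj₂; [_,_]′)
  open import Function using (_∘_)
  open import Relation.Nullary using (¬_; yes; no)
  open import Relation.Binary.PropositionalEquality using (_≡_; refl; sym; trans; cong; cong₂; subst; module ≡-Reasoning)

  inner≡n-2*hamming : ∀ {n} (u v : Word n) → inner u v ≡ + n - + 2 * + hamming u v
  inner≡n-2*hamming []      []      = refl
  inner≡n-2*hamming {suc n} (a ∷ u) (b ∷ v) =
    trans (cong₂ _+_ (sign*sign a b) (inner≡n-2*hamming u v)) (regroup (+ diff a b) (+ hamming u v) (+ n))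
    where
    sign*sign : ∀ a b → sign a * sign b ≡ 1ℤ - + 2 * + diff a b
    sign*sign false false = refl
    sign*sign false true  = refl
    sign*sign true  false = refl
    sign*sign true  true  = refl
    regroup : ∀ x y m → 1ℤ - + 2 * x + (m - + 2 * y) ≡ (1ℤ + m) - + 2 * (x + y)
    regroup = solve-∀

  ∏₁ : ℕ → (ℕ → ℤ) → ℤ
  ∏₁ zero    f = 1ℤ
  ∏₁ (suc r) f = f (suc r) * ∏₁ r f

  ∣factor⇒∣∏₁ : ∀ {P} f r {t} → 1 ≤ t → t ≤ r → P ∣ f t → P ∣ ∏₁ r f
  ∣factor⇒∣∏₁ f zero    (s≤s _) ()
  ∣factor⇒∣∏₁ f (suc r) {t} 1≤t t≤1+r P∣f[t] with t ℕ.≟ suc r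
  ... | yes refl = ∣m⇒∣m*n (∏₁ r f) P∣f[t]
  ... | no  t≢   = ∣n⇒∣m*n (f (suc r)) (∣factor⇒∣∏₁ f r 1≤t (ℕ.s≤s⁻¹ (ℕ.≤∧≢⇒< t≤1+r t≢)) P∣f[t])

  odd-prime∤2 : ∀ {q} → Prime q → ¬ 2 ℕ.∣ q → ¬ q ℕ.∣ 2
  odd-prime∤2 {suc (suc zero)}    _ 2∤q _   = 2∤q ℕ.∣-refl
  odd-prime∤2 {suc (suc (suc _))} _ _   q∣2 = ℕ.<⇒≱ (s≤s (s≤s (s≤s z≤n))) (ℕ.∣⇒≤ q∣2)

  module _ {q : ℕ} (q-prime : Prime q) where

    ∣*⇒⊎ : ∀ x y → + q ∣ x * y → + q ∣ x ⊎ + q ∣ y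
    ∣*⇒⊎ x y q∣xy with euclidsLemma ℤ.∣ x ∣ ℤ.∣ y ∣ q-prime (subst (q ℕ.∣_) (abs-* x y) (∣⇒∣ᵤ q∣xy))
    ... | inj₁ q∣x = inj₁ (∣ᵤ⇒∣ q∣x)
    ... | inj₂ q∣y = inj₂ (∣ᵤ⇒∣ q∣y)

    ∤factors⇒∤∏₁ : ∀ f r → (∀ {t} → 1 ≤ t → t ≤ r → ¬ + q ∣ f t) → ¬ + q ∣ ∏₁ r f
    ∤factors⇒∤∏₁ f zero    _   q∣1 = ¬prime[1] (subst Prime (ℕ.∣1⇒≡1 (∣⇒∣ᵤ q∣1)) q-prime)
    ∤factors⇒∤∏₁ f (suc r) q∤f q∣∏ =
      [ q∤f (s≤s z≤n) ℕ.≤-refl , ∤factors⇒∤∏₁ f r (λ 1≤t t≤r → q∤f 1≤t (ℕ.m≤n⇒m≤1+n t≤r)) ]′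
        (∣*⇒⊎ (f (suc r)) (∏₁ r f) q∣∏)

    ∤2* : ¬ 2 ℕ.∣ q → ∀ {t} → 1 ≤ t → t < q → ¬ + q ∣ + 2 * + t
    ∤2* 2∤q {t} 1≤t t<q q∣2t with euclidsLemma 2 t q-prime (subst (q ℕ.∣_) (abs-* (+ 2) (+ t)) (∣⇒∣ᵤ q∣2t))
    ... | inj₂ q∣t = ℕ.<⇒≱ t<q (ℕ.∣⇒≤ {{ℕ.>-nonZero 1≤t}} q∣t)
    ... | inj₁ q∣2 = odd-prime∤2 q-prime 2∤q q∣2

  ∤⇒∣± : ∀ h d → ¬ suc (2 ℕ.* h) ℕ.∣ d →
         Σ[ t ∈ ℕ ] 1 ≤ t × t ≤ h × (+ suc (2 ℕ.* h) ∣ + d + + t ⊎ + suc (2 ℕ.* h) ∣ + d - + t)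
  ∤⇒∣± h d q∤d with d % suc (2 ℕ.* h) ℕ.≤? h
  ... | yes r≤h = d % q , ∤⇒0<% q d q∤d , r≤h , inj₂ (subst (+ q ∣_) (sym d-r≡) (∣ᵤ⇒∣ (ℕ.n∣m*n (d / q))))
    where
    q = suc (2 ℕ.* h)
    d-r≡ : + d - + (d % q) ≡ + (d / q ℕ.* q)
    d-r≡ = trans (cong (λ m → + m - + (d % q)) (m≡m%n+[m/n]*n d q)) (cancel (+ (d % q)) (+ (d / q ℕ.* q)))
      where
      cancel : ∀ a b → a + b - a ≡ b
      cancel = solve-∀
  ... | no  r≰h = q ∸ d % q , ℕ.m<n⇒0<n∸m (m%n<n d q) , t≤h , inj₁ (∣ᵤ⇒∣ (∣+[∸%] q d))
    where
    q = suc (2 ℕ.* h)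
    t≤h : q ∸ d % q ≤ h
    t≤h = ℕ.≤-trans (ℕ.∸-monoʳ-≤ q (ℕ.≰⇒> r≰h))
                    (ℕ.≤-reflexive (trans (cong (_∸ h) (cong (h ℕ.+_) (ℕ.+-identityʳ h))) (ℕ.m+n∸m≡n h h)))

  shiftedProduct : ∀ {n} → Word n → (r : ℕ) → PolyPair n r
  shiftedProduct {n} u zero    = inner· u (constᴾ 1ℤ) , constᴾ (- + n - + 2 * + 1)
  shiftedProduct {n} u (suc r) = mulAffine u (- + n - + 2 * + suc (suc r)) (shiftedProduct u r)

  evalPair-shiftedProduct : ∀ {n} (u : Word n) r x →
    evalPair (shiftedProduct u r) x ≡ ∏₁ (suc r) (λ t → - (+ 2 * + (hamming u x ℕ.+ t)))
  evalPair-shiftedProduct {n} u zero x = begin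
    eval (inner· u (constᴾ 1ℤ)) x + eval (constᴾ (- + n - + 2 * + 1)) x
      ≡⟨ cong₂ _+_ (trans (eval-inner· u (constᴾ 1ℤ) x) (cong (inner u x *_) (eval-constᴾ 1ℤ x))) (eval-constᴾ _ x) ⟩
    inner u x * 1ℤ + (- + n - + 2 * + 1)
      ≡⟨ cong (λ s → s * 1ℤ + (- + n - + 2 * + 1)) (inner≡n-2*hamming u x) ⟩
    (+ n - + 2 * + hamming u x) * 1ℤ + (- + n - + 2 * + 1)
      ≡⟨ simplify (+ n) (+ hamming u x) ⟩
    - (+ 2 * (+ hamming u x + + 1)) * 1ℤ ∎
    where
    open ≡-Reasoning
    simplify : ∀ m d → (m - + 2 * d) * 1ℤ + (- m - + 2 * + 1) ≡ - (+ 2 * (d + + 1)) * 1ℤ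
    simplify = solve-∀
  evalPair-shiftedProduct {n} u (suc r) x = begin
    evalPair (mulAffine u c (shiftedProduct u r)) x  ≡⟨ eval-mulAffine u c (shiftedProduct u r) x ⟩
    (inner u x + c) * evalPair (shiftedProduct u r) x ≡⟨ cong₂ _*_ factor (evalPair-shiftedProduct u r x) ⟩
    - (+ 2 * + (hamming u x ℕ.+ suc (suc r))) * ∏₁ (suc r) (λ t → - (+ 2 * + (hamming u x ℕ.+ t))) ∎
    where
    open ≡-Reasoning
    c = - + n - + 2 * + suc (suc r)
    factor : inner u x + c ≡ - (+ 2 * (+ hamming u x + + suc (suc r)))
    factor = trans (cong (_+ c) (inner≡n-2*hamming u x)) (simplify (+ n) (+ hamming u x) (+ suc (suc r)))
      where
      simplify : ∀ m d t → m - + 2 * d + (- m - + 2 * t) ≡ - (+ 2 * (d + t))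
      simplify = solve-∀

  symmetricProduct : ∀ {n} → Word n → (h : ℕ) → Poly n (double h)
  symmetricProduct u zero    = constᴾ 1ℤ
  symmetricProduct u (suc h) =
    inner· u (inner· u (symmetricProduct u h)) +[ - (+ 2 * + suc h * (+ 2 * + suc h)) ]· raise (symmetricProduct u h)

  eval-symmetricProduct : ∀ {n} (u : Word n) h x →
    eval (symmetricProduct u h) x ≡ ∏₁ h (λ t → inner u x * inner u x - + 2 * + t * (+ 2 * + t))
  eval-symmetricProduct u zero    x = eval-constᴾ 1ℤ x
  eval-symmetricProduct u (suc h) x = begin
    eval (inner· u (inner· u G) +[ k ]· raise G) x         ≡⟨ eval-+[]· (inner· u (inner· u G)) k (raise G) x ⟩
    eval (inner· u (inner· u G)) x + k * eval (raise G) x ≡⟨ cong₂ (λ A B → A + k * B) inner²·G (eval-raise G x) ⟩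
    s * (s * eval G x) + k * eval G x                     ≡⟨ factor s k (eval G x) ⟩
    (s * s + k) * eval G x                                ≡⟨ cong ((s * s + k) *_) (eval-symmetricProduct u h x) ⟩
    (s * s + k) * ∏₁ h (λ t → s * s - + 2 * + t * (+ 2 * + t)) ∎
    where
    open ≡-Reasoning
    G = symmetricProduct u h
    k = - (+ 2 * + suc h * (+ 2 * + suc h))
    s = inner u x
    inner²·G : eval (inner· u (inner· u G)) x ≡ s * (s * eval G x)
    inner²·G = trans (eval-inner· u (inner· u G) x) (cong (s *_) (eval-inner· u G x))
    factor : ∀ s k g → s * (s * g) + k * g ≡ (s * s + k) * g
    factor = solve-∀

  difference-of-squares : ∀ {n} (u v : Word n) t →
    inner u v * inner u v - + 2 * + t * (+ 2 * + t) ≡ (+ n - + 2 * (+ hamming u v + + t)) * (+ n - + 2 * (+ hamming u v - + t))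
  difference-of-squares {n} u v t =
    trans (cong (λ s → s * s - + 2 * + t * (+ 2 * + t)) (inner≡n-2*hamming u v)) (expand (+ n) (+ hamming u v) (+ t))
    where
    expand : ∀ m d t → (m - + 2 * d) * (m - + 2 * d) - + 2 * t * (+ 2 * t) ≡ (m - + 2 * (d + t)) * (m - + 2 * (d - t))
    expand = solve-∀

  ∣-⇒∣ : ∀ {P x} → P ∣ - x → P ∣ x
  ∣-⇒∣ {x = x} P∣-x = subst (_ ∣_) (neg-involutive x) (∣m⇒∣-m P∣-x)

  upper-bound-full : ∀ {n q} → Prime q → ¬ 2 ℕ.∣ q → ∀ S → Good n q S → length S ≤ binomSum n (q ∸ 1)
  upper-bound-full {n} {suc (suc r)} q-prime 2∤q S (unique , good) =
    subst (length S ≤_) (sym (binomSum≡dim+dim n r)) (biorthogonal⇒length≤dim (+ q) (∣*⇒⊎ q-prime) unique system)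
    where
    q = suc (suc r)
    f : Word n → Word n → ℤ
    f u v = dot (coefficientsPair (shiftedProduct u r)) (monomialsPair r v)
    f≡∏ : ∀ u v → f u v ≡ ∏₁ (suc r) (λ t → - (+ 2 * + (hamming u v ℕ.+ t)))
    f≡∏ u v = trans (sym (evalPair≡dot (shiftedProduct u r) v)) (evalPair-shiftedProduct u r v)
    q∤factor : ∀ u {t} → 1 ≤ t → t ≤ suc r → ¬ + q ∣ - (+ 2 * + (hamming u u ℕ.+ t))
    q∤factor u {t} 1≤t t≤1+r q∣ =
      ∤2* q-prime 2∤q 1≤t (s≤s t≤1+r) (subst (λ d → + q ∣ + 2 * + (d ℕ.+ t)) (hamming-self u) (∣-⇒∣ q∣))
    system : BiorthogonalMod (+ q) S (λ u → coefficientsPair (shiftedProduct u r)) (monomialsPair r)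
    system = record
      { off-diagonal = λ {u} {v} u∈S v∈S u≢v →
          let t , 1≤t , t<q , q∣d+t = ∤⇒∣+ q (hamming u v) (good u v u∈S v∈S u≢v)
          in subst (+ q ∣_) (sym (f≡∏ u v))
               (∣factor⇒∣∏₁ (λ t → - (+ 2 * + (hamming u v ℕ.+ t))) (suc r) 1≤t (ℕ.s≤s⁻¹ t<q)
                 (∣m⇒∣-m (∣n⇒∣m*n (+ 2) (∣ᵤ⇒∣ q∣d+t))))
      ; diagonal = λ {u} _ → ∤factors⇒∤∏₁ q-prime _ (suc r) (q∤factor u) ∘ subst (+ q ∣_) (f≡∏ u u)
      }

  upper-bound-even : ∀ {n} h → Prime (suc (2 ℕ.* h)) → suc (2 ℕ.* h) ℕ.∣ n →
                     ∀ S → Good n (suc (2 ℕ.* h)) S → length S ≤ evenBinomSum n h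
  upper-bound-even {n} h q-prime q∣n S (unique , good) =
    subst (length S ≤_) (sym (evenBinomSum≡dim n h)) (biorthogonal⇒length≤dim (+ q) (∣*⇒⊎ q-prime) unique system)
    where
    q = suc (2 ℕ.* h)
    f : Word n → Word n → ℤ
    f u v = dot (coefficients (symmetricProduct u h)) (monomials (double h) v)
    q∣+n : + q ∣ + n
    q∣+n = ∣ᵤ⇒∣ q∣n
    f≡∏ : ∀ u v → f u v ≡ ∏₁ h (λ t → inner u v * inner u v - + 2 * + t * (+ 2 * + t))
    f≡∏ u v = trans (sym (eval≡dot (symmetricProduct u h) v)) (eval-symmetricProduct u h v)
    q∣factor : ∀ d t → + q ∣ + d + + t ⊎ + q ∣ + d - + t →
               + q ∣ (+ n - + 2 * (+ d + + t)) * (+ n - + 2 * (+ d - + t))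
    q∣factor d t (inj₁ q∣d+t) = ∣m⇒∣m*n (+ n - + 2 * (+ d - + t)) (∣m∣n⇒∣m-n q∣+n (∣n⇒∣m*n (+ 2) q∣d+t))
    q∣factor d t (inj₂ q∣d-t) = ∣n⇒∣m*n (+ n - + 2 * (+ d + + t)) (∣m∣n⇒∣m-n q∣+n (∣n⇒∣m*n (+ 2) q∣d-t))
    q∤factor : ∀ u {t} → 1 ≤ t → t ≤ h → ¬ + q ∣ inner u u * inner u u - + 2 * + t * (+ 2 * + t)
    q∤factor u {t} 1≤t t≤h q∣ =
      [ q∤2t , q∤2t ]′ (∣*⇒⊎ q-prime (+ 2 * + t) (+ 2 * + t) (∣-⇒∣ (∣m+n∣m⇒∣n q∣ q∣inner²)))
      where
      q∤2t = ∤2* q-prime (2∤1+2* h) 1≤t (s≤s (ℕ.≤-trans t≤h (ℕ.m≤m+n h _)))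
      q∣inner² : + q ∣ inner u u * inner u u
      q∣inner² = ∣m⇒∣m*n (inner u u) (subst (+ q ∣_) (sym (inner-self u)) q∣+n)
    system : BiorthogonalMod (+ q) S (λ u → coefficients (symmetricProduct u h)) (monomials (double h))
    system = record
      { off-diagonal = λ {u} {v} u∈S v∈S u≢v →
          let t , 1≤t , t≤h , q∣d±t = ∤⇒∣± h (hamming u v) (good u v u∈S v∈S u≢v)
          in subst (+ q ∣_) (sym (f≡∏ u v))
               (∣factor⇒∣∏₁ (λ t → inner u v * inner u v - + 2 * + t * (+ 2 * + t)) h 1≤t t≤h
                 (subst (+ q ∣_) (sym (difference-of-squares u v t)) (q∣factor (hamming u v) t q∣d±t)))
      ; diagonal = λ {u} _ → ∤factors⇒∤∏₁ q-prime _ h (q∤factor u) ∘ subst (+ q ∣_) (f≡∏ u u)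
      }

module LowerBounds where

  open Residues using (2∤1+2*; m<o⇒n<o⇒m+n<2*o)
  open Hamming
  open import Data.Nat
  open import Data.Nat.Properties
  open import Data.Nat.Combinatorics using (_C_; nCk+nC[k+1]≡[n+1]C[k+1])
  open import Data.Nat.Divisibility using (_∣_; _∣0; ∣m∣n⇒∣m+n; m∣m*n)
  open import Data.Nat.Tactic.RingSolver using (solve-∀)
  open import Data.Bool using (true; false)
  open import Data.Vec using ([]; _∷_; replicate)
  open import Data.Vec.Properties using (∷-injectiveʳ)
  open import Data.List using (List; []; _∷_; _++_; map; length; concatMap; downFrom)
  open import Data.Nat.ListAction using (sum)
  open import Data.List.Properties using (length-++; length-map)
  open import Data.List.Membership.Propositional using (_∈_)
  open import Data.List.Membership.Propositional.Properties using (∈-++⁻; ∈-map⁻; ∈-downFrom⁻)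
  open import Data.List.Relation.Unary.Any using (here; there)
  open import Data.List.Relation.Unary.All as All using ()
  open import Data.List.Relation.Unary.Unique.Propositional using (Unique)
  open import Data.List.Relation.Unary.Unique.Propositional.Properties using (map⁺; ++⁺; downFrom⁺)
  open import Data.List.Relation.Unary.AllPairs using ([]; _∷_)
  open import Data.Product using (Σ-syntax; _×_; _,_)
  open import Data.Sum using (inj₁; inj₂)
  open import Function using (_∘_)
  open import Relation.Nullary using (¬_)
  open import Relation.Binary.PropositionalEquality using (_≡_; _≢_; refl; sym; trans; cong; cong₂; subst; module ≡-Reasoning)

  wordsOfWeight : ∀ n → ℕ → List (Word n)
  wordsOfWeight n       zero    = replicate n false ∷ []
  wordsOfWeight zero    (suc k) = []
  wordsOfWeight (suc n) (suc k) = map (false ∷_) (wordsOfWeight n (suc k)) ++ map (true ∷_) (wordsOfWeight n k)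

  length-wordsOfWeight : ∀ n k → length (wordsOfWeight n k) ≡ n C k
  length-wordsOfWeight zero    zero    = refl
  length-wordsOfWeight (suc n) zero    = refl
  length-wordsOfWeight zero    (suc k) = refl
  length-wordsOfWeight (suc n) (suc k) = begin
    length (map (false ∷_) (wordsOfWeight n (suc k)) ++ map (true ∷_) (wordsOfWeight n k))
      ≡⟨ length-++ (map (false ∷_) (wordsOfWeight n (suc k))) ⟩
    length (map (false ∷_) (wordsOfWeight n (suc k))) + length (map (true ∷_) (wordsOfWeight n k))
      ≡⟨ cong₂ _+_ (length-map (false ∷_) (wordsOfWeight n (suc k))) (length-map (true ∷_) (wordsOfWeight n k)) ⟩
    length (wordsOfWeight n (suc k)) + length (wordsOfWeight n k)
      ≡⟨ cong₂ _+_ (length-wordsOfWeight n (suc k)) (length-wordsOfWeight n k) ⟩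
    n C suc k + n C k
      ≡⟨ +-comm (n C suc k) (n C k) ⟩
    n C k + n C suc k
      ≡⟨ nCk+nC[k+1]≡[n+1]C[k+1] n k ⟩
    suc n C suc k ∎
    where open ≡-Reasoning

  weight-replicate-false : ∀ n → weight (replicate n false) ≡ 0
  weight-replicate-false zero    = refl
  weight-replicate-false (suc n) = weight-replicate-false n

  ∈-wordsOfWeight⁻ : ∀ {n k x} → x ∈ wordsOfWeight n k → weight x ≡ k
  ∈-wordsOfWeight⁻ {n} {zero} (here refl) = weight-replicate-false n
  ∈-wordsOfWeight⁻ {suc n} {suc k} x∈ with ∈-++⁻ (map (false ∷_) (wordsOfWeight n (suc k))) x∈
  ... | inj₁ x∈₀ with ∈-map⁻ (false ∷_) x∈₀
  ...   | _ , y∈ , refl = ∈-wordsOfWeight⁻ y∈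
  ∈-wordsOfWeight⁻ {suc n} {suc k} x∈ | inj₂ x∈₁ with ∈-map⁻ (true ∷_) x∈₁
  ...   | _ , y∈ , refl = cong suc (∈-wordsOfWeight⁻ y∈)

  wordsOfWeight-unique : ∀ n k → Unique (wordsOfWeight n k)
  wordsOfWeight-unique n       zero    = All.[] ∷ []
  wordsOfWeight-unique zero    (suc k) = []
  wordsOfWeight-unique (suc n) (suc k) =
    ++⁺ (map⁺ ∷-injectiveʳ (wordsOfWeight-unique n (suc k))) (map⁺ ∷-injectiveʳ (wordsOfWeight-unique n k)) heads-differ
    where
    heads-differ : ∀ {x} → ¬ (x ∈ map (false ∷_) (wordsOfWeight n (suc k)) × x ∈ map (true ∷_) (wordsOfWeight n k))
    heads-differ (x∈₀ , x∈₁) with ∈-map⁻ (false ∷_) x∈₀ | ∈-map⁻ (true ∷_) x∈₁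
    ... | _ , _ , refl | _ , _ , ()

  wordsOfWeightIn : ∀ n → List ℕ → List (Word n)
  wordsOfWeightIn n = concatMap (wordsOfWeight n)

  length-wordsOfWeightIn : ∀ n ws → length (wordsOfWeightIn n ws) ≡ sum (map (n C_) ws)
  length-wordsOfWeightIn n []       = refl
  length-wordsOfWeightIn n (w ∷ ws) = trans (length-++ (wordsOfWeight n w))
    (cong₂ _+_ (length-wordsOfWeight n w) (length-wordsOfWeightIn n ws))

  ∈-wordsOfWeightIn⁻ : ∀ {n x} ws → x ∈ wordsOfWeightIn n ws → weight x ∈ ws
  ∈-wordsOfWeightIn⁻ {n} (w ∷ ws) x∈ with ∈-++⁻ (wordsOfWeight n w) x∈
  ... | inj₁ x∈w  = here (∈-wordsOfWeight⁻ x∈w)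
  ... | inj₂ x∈ws = there (∈-wordsOfWeightIn⁻ ws x∈ws)

  wordsOfWeightIn-unique : ∀ n {ws} → Unique ws → Unique (wordsOfWeightIn n ws)
  wordsOfWeightIn-unique n []               = []
  wordsOfWeightIn-unique n {w ∷ ws} (w∉ws ∷ unique) =
    ++⁺ (wordsOfWeight-unique n w) (wordsOfWeightIn-unique n unique)
        (λ (x∈w , x∈ws) → All.lookup w∉ws (∈-wordsOfWeightIn⁻ ws x∈ws) (sym (∈-wordsOfWeight⁻ x∈w)))

  module _ {n q : ℕ} where

    Good-++ : ∀ {A B} → Good n q A → Good n q B → (∀ {u v} → u ∈ A → v ∈ B → ¬ q ∣ hamming u v) →
              Good n q (A ++ B)
    Good-++ {A} {B} (uniqueA , goodA) (uniqueB , goodB) cross = ++⁺ uniqueA uniqueB disjoint , good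
      where
      disjoint : ∀ {x} → ¬ (x ∈ A × x ∈ B)
      disjoint {x} (x∈A , x∈B) = cross x∈A x∈B (subst (q ∣_) (sym (hamming-self x)) (q ∣0))
      good : ∀ u v → u ∈ A ++ B → v ∈ A ++ B → u ≢ v → ¬ q ∣ hamming u v
      good u v u∈ v∈ u≢v with ∈-++⁻ A u∈ | ∈-++⁻ A v∈
      ... | inj₁ u∈A | inj₁ v∈A = goodA u v u∈A v∈A u≢v
      ... | inj₂ u∈B | inj₂ v∈B = goodB u v u∈B v∈B u≢v
      ... | inj₁ u∈A | inj₂ v∈B = cross u∈A v∈B
      ... | inj₂ u∈B | inj₁ v∈A = cross v∈A u∈B ∘ subst (q ∣_) (hamming-sym u v)

    Good-map-complement : ∀ {S} → Good n q S → Good n q (map complement S)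
    Good-map-complement {S} (unique , good) = map⁺ complement-injective unique , good′
      where
      good′ : ∀ u v → u ∈ map complement S → v ∈ map complement S → u ≢ v → ¬ q ∣ hamming u v
      good′ _ _ u∈ v∈ u≢v with ∈-map⁻ complement u∈ | ∈-map⁻ complement v∈
      ... | u , u∈S , refl | v , v∈S , refl =
        good u v u∈S v∈S (u≢v ∘ cong complement) ∘ subst (q ∣_) (hamming-complement u v)

    Good-wordsOfWeightIn : ¬ 2 ∣ q → ∀ {ws} → Unique ws → (∀ {a b} → a ∈ ws → b ∈ ws → 2 ∣ a + b) →
                           (∀ {a} → a ∈ ws → a < q) → Good n q (wordsOfWeightIn n ws)
    Good-wordsOfWeightIn 2∤q {ws} unique same-parity below = wordsOfWeightIn-unique n unique , good
      where
      good : ∀ u v → u ∈ wordsOfWeightIn n ws → v ∈ wordsOfWeightIn n ws → u ≢ v → ¬ q ∣ hamming u v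
      good u v u∈ v∈ u≢v = ¬∣hamming 2∤q u≢v (same-parity wu∈ wv∈) (m<o⇒n<o⇒m+n<2*o (below wu∈) (below wv∈))
        where
        wu∈ = ∈-wordsOfWeightIn⁻ ws u∈
        wv∈ = ∈-wordsOfWeightIn⁻ ws v∈

  evenWeights : ℕ → List ℕ
  evenWeights h = map (2 *_) (downFrom (suc h))

  oddWeights : ℕ → List ℕ
  oddWeights h = map (λ i → suc (2 * i)) (downFrom h)

  ∈-evenWeights⁻ : ∀ {h w} → w ∈ evenWeights h → Σ[ i ∈ ℕ ] i ≤ h × w ≡ 2 * i
  ∈-evenWeights⁻ w∈ with ∈-map⁻ (2 *_) w∈
  ... | i , i∈ , w≡ = i , s≤s⁻¹ (∈-downFrom⁻ i∈) , w≡

  ∈-oddWeights⁻ : ∀ {h w} → w ∈ oddWeights h → Σ[ i ∈ ℕ ] i < h × w ≡ suc (2 * i)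
  ∈-oddWeights⁻ w∈ with ∈-map⁻ (λ i → suc (2 * i)) w∈
  ... | i , i∈ , w≡ = i , ∈-downFrom⁻ i∈ , w≡

  evenWeights-unique : ∀ h → Unique (evenWeights h)
  evenWeights-unique h = map⁺ (*-cancelˡ-≡ _ _ 2) (downFrom⁺ (suc h))

  oddWeights-unique : ∀ h → Unique (oddWeights h)
  oddWeights-unique h = map⁺ (*-cancelˡ-≡ _ _ 2 ∘ suc-injective) (downFrom⁺ h)

  sum-evenWeights : ∀ n h → sum (map (n C_) (evenWeights h)) ≡ evenBinomSum n h
  sum-evenWeights n zero    = +-identityʳ (n C 0)
  sum-evenWeights n (suc h) = cong (n C (2 * suc h) +_) (sum-evenWeights n h)

  binomSum≡even+odd : ∀ n h → binomSum n (2 * h) ≡ evenBinomSum n h + sum (map (n C_) (oddWeights h))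
  binomSum≡even+odd n zero    = sym (+-identityʳ (n C 0))
  binomSum≡even+odd n (suc h) = begin
    binomSum n (2 * suc h)                                            ≡⟨ cong (binomSum n) (*-suc 2 h) ⟩
    n C (2 + 2 * h) + (n C (1 + 2 * h) + binomSum n (2 * h))
      ≡⟨ cong (λ s → n C (2 + 2 * h) + (n C (1 + 2 * h) + s)) (binomSum≡even+odd n h) ⟩
    n C (2 + 2 * h) + (n C (1 + 2 * h) + (evenBinomSum n h + odd))
      ≡⟨ regroup (n C (2 + 2 * h)) (n C (1 + 2 * h)) (evenBinomSum n h) odd ⟩
    n C (2 + 2 * h) + evenBinomSum n h + (n C (1 + 2 * h) + odd)
      ≡⟨ cong (λ k → n C k + evenBinomSum n h + (n C (1 + 2 * h) + odd)) (sym (*-suc 2 h)) ⟩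
    n C (2 * suc h) + evenBinomSum n h + (n C (1 + 2 * h) + odd)      ∎
    where
    open ≡-Reasoning
    odd = sum (map (n C_) (oddWeights h))
    regroup : ∀ a b e o → a + (b + (e + o)) ≡ a + e + (b + o)
    regroup = solve-∀

  module _ (h n : ℕ) where

    private
      q = suc (2 * h)

      even-same-parity : ∀ {a b} → a ∈ evenWeights h → b ∈ evenWeights h → 2 ∣ a + b
      even-same-parity a∈ b∈ with ∈-evenWeights⁻ a∈ | ∈-evenWeights⁻ b∈
      ... | i , _ , refl | j , _ , refl = ∣m∣n⇒∣m+n (m∣m*n i) (m∣m*n j)

      even-below : ∀ {a} → a ∈ evenWeights h → a < q
      even-below a∈ with ∈-evenWeights⁻ a∈
      ... | i , i≤h , refl = s≤s (*-monoʳ-≤ 2 i≤h)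

      odd-same-parity : ∀ {a b} → a ∈ oddWeights h → b ∈ oddWeights h → 2 ∣ a + b
      odd-same-parity a∈ b∈ with ∈-oddWeights⁻ a∈ | ∈-oddWeights⁻ b∈
      ... | i , _ , refl | j , _ , refl = subst (2 ∣_) (sym (odd+odd i j)) (m∣m*n (suc (i + j)))
        where
        odd+odd : ∀ i j → suc (2 * i) + suc (2 * j) ≡ 2 * suc (i + j)
        odd+odd = solve-∀

      odd-below : ∀ {a} → a ∈ oddWeights h → suc a < q
      odd-below a∈ with ∈-oddWeights⁻ a∈
      ... | i , i<h , refl = s≤s (subst (_≤ 2 * h) (*-suc 2 i) (*-monoʳ-≤ 2 i<h))

      evenWords oddWords : List (Word n)
      evenWords = wordsOfWeightIn n (evenWeights h)
      oddWords  = wordsOfWeightIn n (oddWeights h)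

      evenWords-good : Good n q evenWords
      evenWords-good = Good-wordsOfWeightIn (2∤1+2* h) (evenWeights-unique h) even-same-parity even-below

    lower-bound-even : Σ[ S ∈ List (Word n) ] Good n q S × evenBinomSum n h ≤ length S
    lower-bound-even = evenWords , evenWords-good , ≤-reflexive (sym length≡)
      where
      length≡ : length evenWords ≡ evenBinomSum n h
      length≡ = trans (length-wordsOfWeightIn n (evenWeights h)) (sum-evenWeights n h)

    lower-bound-full : q ∣ suc n → Σ[ S ∈ List (Word n) ] Good n q S × binomSum n (2 * h) ≤ length S
    lower-bound-full q∣1+n =
      S , Good-++ evenWords-good (Good-map-complement oddWords-good) cross , ≤-reflexive (sym length≡)
      where
      S = evenWords ++ map complement oddWords
      oddWords-good : Good n q oddWords
      oddWords-good = Good-wordsOfWeightIn (2∤1+2* h) (oddWeights-unique h) odd-same-parity (<⇒≤ ∘ odd-below)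
      cross : ∀ {u v} → u ∈ evenWords → v ∈ map complement oddWords → ¬ q ∣ hamming u v
      cross {u} u∈ v∈ with ∈-map⁻ complement v∈
      ... | v , v∈ , refl = ¬∣hamming-complement (2∤1+2* h) q∣1+n u v even-sum bound
        where
        wu∈ = ∈-wordsOfWeightIn⁻ (evenWeights h) u∈
        wv∈ = ∈-wordsOfWeightIn⁻ (oddWeights h) v∈
        even-sum : 2 ∣ suc (weight u + weight v)
        even-sum with ∈-evenWeights⁻ wu∈ | ∈-oddWeights⁻ wv∈
        ... | i , _ , wu≡ | j , _ , wv≡ =
          subst (2 ∣_) (sym (trans (cong suc (cong₂ _+_ wu≡ wv≡)) (even+odd+1 i j))) (m∣m*n (suc (i + j)))
          where
          even+odd+1 : ∀ i j → suc (2 * i + suc (2 * j)) ≡ 2 * suc (i + j)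
          even+odd+1 = solve-∀
        bound : suc (weight u + weight v) < 2 * q
        bound = subst (_< 2 * q) (+-suc (weight u) (weight v)) (m<o⇒n<o⇒m+n<2*o (even-below wu∈) (odd-below wv∈))
      length≡ : length S ≡ binomSum n (2 * h)
      length≡ = begin
        length (evenWords ++ map complement oddWords)       ≡⟨ length-++ evenWords ⟩
        length evenWords + length (map complement oddWords) ≡⟨ cong (length evenWords +_) (length-map complement oddWords) ⟩
        length evenWords + length oddWords
          ≡⟨ cong₂ _+_ (length-wordsOfWeightIn n (evenWeights h)) (length-wordsOfWeightIn n (oddWeights h)) ⟩
        sum (map (n C_) (evenWeights h)) + sum (map (n C_) (oddWeights h))
          ≡⟨ cong (_+ sum (map (n C_) (oddWeights h))) (sum-evenWeights n h) ⟩
        evenBinomSum n h + sum (map (n C_) (oddWeights h))  ≡⟨ sym (binomSum≡even+odd n h) ⟩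
        binomSum n (2 * h) ∎
        where open ≡-Reasoning

open Residues using (odd⇒≡1+2*; 2*n/2≡n)
open UpperBounds using (upper-bound-full; upper-bound-even)
open LowerBounds using (lower-bound-even; lower-bound-full)
open import Data.Nat using (ℕ; suc; _∸_; _/_; _≤_)
open import Data.Nat.Divisibility using (_∣_)
open import Data.Nat.Primality using (Prime)
open import Data.List using (List; length)
open import Data.Product using (_×_; Σ; _,_)
open import Relation.Nullary using (¬_)
open import Relation.Binary.PropositionalEquality using (refl)

theorem1p8 : (q n : ℕ) → Prime q → ¬ (2 ∣ q) → 1 ≤ n →
    ((∀ S → Good n q S → length S ≤ binomSum n (q ∸ 1))
    × (q ∣ n → ∀ S → Good n q S → length S ≤ evenBinomSum n ((q ∸ 1) / 2))
    × Σ (List (Word n)) (λ S → Good n q S × evenBinomSum n ((q ∸ 1) / 2) ≤ length S)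
    × (q ∣ suc n → Σ (List (Word n)) (λ S → Good n q S × binomSum n (q ∸ 1) ≤ length S)))
theorem1p8 q n q-prime 2∤q _ with odd⇒≡1+2* 2∤q
... | h , refl rewrite 2*n/2≡n h =
    upper-bound-full q-prime 2∤q
  , upper-bound-even h q-prime
  , lower-bound-even h n
  , lower-bound-full h n
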